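{- Let $m,n$ be positive integers and let $a$ be a positive odd integer. Then $$t(a,a,2a,8m;n)=\frac 23N(a,a,2a,8m;8n+8m+4a)-2N(a,a,2a,8m;2n+2m+a).$$
   Context: For positive integers $a,b,c,d$ and a nonnegative integer $n$, $N(a,b,c,d;n)$ denotes the number of $(x,y,z,w)\in\mathbb Z^4$ with $n=ax^2+by^2+cz^2+dw^2$, and $t(a,b,c,d;n)$ denotes the number of $(x,y,z,w)\in\mathbb Z^4$ with $n=a\frac{x(x-1)}2+b\frac{y(y-1)}2+c\frac{z(z-1)}2+d\frac{w(w-1)}2$. -}

module Defs where

open import Data.Nat using (ℕ; zero; suc)
open import Data.Integer using (ℤ; +_; -[1+_]; _+_; _*_; _-_)
open import Data.Integer.DivMod using () renaming (_/_ to _divℤ_)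
open import Data.List using (List; []; _∷_; map; sum; length; filter; cartesianProduct; upTo; concatMap)
open import Data.Product using (_×_; _,_)
open import Relation.Binary.PropositionalEquality using (_≡_)
open import Data.Integer.Properties using (_≟_)

range : ℕ → List ℤ
range b = map (λ k → + k - + b) (upTo (suc (b Data.Nat.+ b)))

quads : List ℤ → List (ℤ × ℤ × ℤ × ℤ)
quads l = concatMap (λ x → concatMap (λ y → concatMap (λ z → map (λ w → (x , y , z , w)) l) l) l) l

-- Number of (x,y,z,w) ∈ ℤ^4 with n = a x² + b y² + c z² + d w².
-- For positive a,b,c,d every solution has |x|,|y|,|z|,|w| ≤ n, so searching
-- the box [-n,n]^4 counts all integer solutions.
N : ℕ → ℕ → ℕ → ℕ → ℕ → ℕ
N a b c d n = length (filter (λ { (x , y , z , w) →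
  (+ a * (x * x) + + b * (y * y) + + c * (z * z) + + d * (w * w)) ≟ + n })
  (quads (range n)))

-- x(x-1)/2 for integer x (always an integer)
tri : ℤ → ℤ
tri x = (x * (x - + 1)) divℤ (+ 2)

-- Number of (x,y,z,w) ∈ ℤ^4 with n = a x(x-1)/2 + b y(y-1)/2 + c z(z-1)/2 + d w(w-1)/2.
-- For positive coefficients every solution has each variable in [-(n+1), n+1]
-- (x(x-1)/2 ≥ |x| - 1), so searching that box counts all integer solutions.
t : ℕ → ℕ → ℕ → ℕ → ℕ → ℕ
t a b c d n = length (filter (λ { (x , y , z , w) →
  (+ a * tri x + + b * tri y + + c * tri z + + d * tri w) ≟ + n })
  (quads (range (suc n))))

-- Put F = (a, a, 2a, 8m), M = (a, a, 2a, 2m) and K = 2n + 2m + a, which is odd.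
-- Since (2x - 1)² = 8·x(x-1)/2 + 1, the substitution x ↦ 2x - 1 identifies the solutions counted by
-- t(a,a,2a,8m; n) with the solutions of F = 4K having all four coordinates odd.
-- As a is odd, the first three coordinates of a solution of F = 4K have a common parity. The maps
-- (x, y, z) ↦ (2x, 2y, 2z), (x+y+2z, x+y-2z, x-y), (x+y+2z, 2z-x-y, x-y) multiply x² + y² + 2z² by 4, and
-- (extended by w ↦ w) they send the solutions of M = K bijectively onto the solutions of F = 4K whose first
-- three coordinates are even, resp. odd with X ≡ Y (mod 4), resp. odd with X ≢ Y (mod 4).
-- So N(F; 4K) = 3 N(M; K), and restricting to odd w gives t = 2S, where S counts the solutions of M = K
-- with w odd. Finally N(M; K) = N(F; K) + S by doubling w, and eliminating S gives the formula.

module Submission where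

open import Defs
open import Data.Empty using (⊥-elim)
open import Data.Integer using (ℤ; +_; -[1+_])
open import Data.List using (List; []; _∷_; map; filter; length)
open import Data.List.Membership.Propositional using (_∈_)
open import Data.List.Relation.Unary.Unique.Propositional using (Unique)
import Data.List.Relation.Unary.Unique.Propositional.Properties as Unique
open import Data.Nat using (ℕ; zero; suc)
open import Data.Product using (_×_; _,_; proj₁; proj₂; ∃-syntax)
open import Data.Sum using (_⊎_; inj₁; inj₂)
open import Function using (id; _∘_)
open import Function.Definitions using (Injective)
open import Level using (0ℓ)
open import Relation.Binary.PropositionalEquality
  using (_≡_; _≢_; refl; sym; trans; cong; cong₂; subst; module ≡-Reasoning)
open import Relation.Nullary using (¬_; yes; no)
open import Relation.Unary using (Pred; Decidable; _⊆_; _≐_; _∩_; ∁)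
open import Relation.Unary.Properties using (∁?)

module Listings where

  open import Data.Bool using (true; false)
  open import Data.List.Properties using (length-map)
  open import Data.List.Membership.Propositional.Properties using (∈-map⁺; ∈-map⁻; ∈-filter⁺; ∈-filter⁻)
  open import Data.List.Membership.Propositional.Properties.WithK using (unique∧set⇒bag)
  open import Data.List.Relation.Binary.BagAndSetEquality using (∼bag⇒↭)
  open import Data.List.Relation.Binary.Permutation.Propositional.Properties using (↭-length)
  open import Data.Nat using (_+_)
  open import Data.Nat.Properties using (+-suc)
  open import Function.Bundles using (mk⇔)
  open import Relation.Nullary using (does)

  record _Lists_ {A : Set} (l : List A) (P : Pred A 0ℓ) : Set where
    field
      unique   : Unique l
      sound    : ∀ {a} → a ∈ l → P a
      complete : ∀ {a} → P a → a ∈ l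

  open _Lists_

  record BijectionOn {A B : Set} (f : A → B) (P : Pred A 0ℓ) (Q : Pred B 0ℓ) : Set where
    field
      injective : Injective _≡_ _≡_ f
      mapsTo    : ∀ {a} → P a → Q (f a)
      onto      : ∀ {b} → Q b → ∃[ a ] P a × f a ≡ b

  open BijectionOn

  module _ {A : Set} {P : Pred A 0ℓ} where

    filter-Lists : (P? : Decidable P) {l : List A} → Unique l → P ⊆ (_∈ l) → filter P? l Lists P
    filter-Lists P? {l} u c = record
      { unique   = Unique.filter⁺ P? u
      ; sound    = λ a∈ → proj₂ (∈-filter⁻ P? {xs = l} a∈)
      ; complete = λ p → ∈-filter⁺ P? (c p) p
      }

    Lists-filter : {R : Pred A 0ℓ} (R? : Decidable R) {l : List A} → l Lists P → filter R? l Lists (P ∩ R)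
    Lists-filter R? {l} ls = record
      { unique   = Unique.filter⁺ R? (unique ls)
      ; sound    = λ a∈ → let a∈l , r = ∈-filter⁻ R? {xs = l} a∈ in sound ls a∈l , r
      ; complete = λ (p , r) → ∈-filter⁺ R? (complete ls p) r
      }

    Lists-resp : {Q : Pred A 0ℓ} {l : List A} → P ≐ Q → l Lists P → l Lists Q
    Lists-resp (P⊆Q , Q⊆P) ls = record
      { unique = unique ls ; sound = λ a∈ → P⊆Q (sound ls a∈) ; complete = λ q → complete ls (Q⊆P q) }

    Lists-length : {l l′ : List A} → l Lists P → l′ Lists P → length l ≡ length l′
    Lists-length ls ls′ = ↭-length (∼bag⇒↭ (unique∧set⇒bag (unique ls) (unique ls′)
      (mk⇔ (λ a∈ → complete ls′ (sound ls a∈)) (λ a∈ → complete ls (sound ls′ a∈)))))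

  length-filter-∁ : {A : Set} {R : Pred A 0ℓ} (R? : Decidable R) (l : List A) →
    length l ≡ length (filter R? l) + length (filter (∁? R?) l)
  length-filter-∁ R? []      = refl
  length-filter-∁ R? (a ∷ l) with does (R? a)
  ... | true  = cong suc (length-filter-∁ R? l)
  ... | false = trans (cong suc (length-filter-∁ R? l)) (sym (+-suc _ _))

  module _ {A B : Set} {f : A → B} {P : Pred A 0ℓ} {Q : Pred B 0ℓ} where

    Lists-map : BijectionOn f P Q → {l : List A} → l Lists P → map f l Lists Q
    Lists-map bij ls = record
      { unique   = Unique.map⁺ (injective bij) (unique ls)
      ; sound    = λ b∈ → let _ , a∈ , b≡fa = ∈-map⁻ f b∈ in subst Q (sym b≡fa) (mapsTo bij (sound ls a∈))
      ; complete = λ q → let _ , p , fa≡b = onto bij q in subst (_∈ map f _) fa≡b (∈-map⁺ f (complete ls p))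
      }

    BijectionOn-length : BijectionOn f P Q → {l : List A} {l′ : List B} → l Lists P → l′ Lists Q →
      length l ≡ length l′
    BijectionOn-length bij {l} ls ls′ = trans (sym (length-map f l)) (Lists-length (Lists-map bij ls) ls′)

    BijectionOn-∩ : {R : Pred B 0ℓ} {R′ : Pred A 0ℓ} → BijectionOn f P Q → (λ a → R (f a)) ≐ R′ →
      BijectionOn f (P ∩ R′) (Q ∩ R)
    BijectionOn-∩ {R} bij (to , from) = record
      { injective = injective bij
      ; mapsTo    = λ (p , r′) → mapsTo bij p , from r′
      ; onto      = λ (q , r) → let a , p , fa≡b = onto bij q in a , (p , to (subst R (sym fa≡b) r)) , fa≡b
      }

open Listings

module Boxes where

  open import Data.Integer using (_+_; _*_; _-_; -_; ∣_∣)
  open import Data.Integer.DivMod using (div-pos-is-/ℕ) renaming (_/_ to _div_)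
  import Data.Integer.Properties as ℤ
  open import Algebra.Properties.AbelianGroup ℤ.+-0-abelianGroup using (∙-cancelʳ)
  open import Data.Integer.Tactic.RingSolver using (solve-∀)
  open import Data.List using (_++_; concatMap; cartesianProduct)
  open import Data.List.Properties using (map-++; map-∘; map-id; concatMap-cong)
  open import Data.List.Membership.Propositional.Properties using (∈-map⁺; ∈-upTo⁺; ∈-cartesianProduct⁺)
  open import Data.Nat using (_≤_; z≤n; s≤s; NonZero) renaming (_+_ to _+ℕ_; _*_ to _*ℕ_)
  open import Data.Nat.Combinatorics using (_C_; nC1≡n; nCk+nC[k+1]≡[n+1]C[k+1])
  import Data.Nat.DivMod as ℕ
  import Data.Nat.Properties as ℕ

  ℤ⁴ : Set
  ℤ⁴ = ℤ × ℤ × ℤ × ℤ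

  quads-cartesianProduct : ∀ l → quads l ≡ cartesianProduct l (cartesianProduct l (cartesianProduct l l))
  quads-cartesianProduct l = sym (begin
    cartesianProduct l (cartesianProduct l (cartesianProduct l l))
      ≡⟨ map-id _ ⟨
    map id (cartesianProduct l (cartesianProduct l (cartesianProduct l l)))
      ≡⟨ map-cartesianProduct id l _ ⟩
    concatMap (λ x → map (x ,_) (cartesianProduct l (cartesianProduct l l))) l
      ≡⟨ concatMap-cong (λ x → map-cartesianProduct (x ,_) l _) l ⟩
    concatMap (λ x → concatMap (λ y → map (λ p → x , y , p) (cartesianProduct l l)) l) l
      ≡⟨ concatMap-cong (λ x → concatMap-cong (λ y → map-cartesianProduct (λ p → x , y , p) l l) l) l ⟩
    quads l ∎)
    where
    open ≡-Reasoning
    map-cartesianProduct : {A B C : Set} (f : A × B → C) (xs : List A) (ys : List B) →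
      map f (cartesianProduct xs ys) ≡ concatMap (λ x → map (λ y → f (x , y)) ys) xs
    map-cartesianProduct f []       ys = refl
    map-cartesianProduct f (x ∷ xs) ys = begin
      map f (map (x ,_) ys ++ cartesianProduct xs ys)           ≡⟨ map-++ f (map (x ,_) ys) _ ⟩
      map f (map (x ,_) ys) ++ map f (cartesianProduct xs ys)   ≡⟨ cong₂ _++_ (sym (map-∘ ys)) (map-cartesianProduct f xs ys) ⟩
      map (λ y → f (x , y)) ys ++ concatMap (λ x → map (λ y → f (x , y)) ys) xs ∎

  quads-unique : ∀ {l} → Unique l → Unique (quads l)
  quads-unique {l} u = subst Unique (sym (quads-cartesianProduct l))
    (Unique.cartesianProduct⁺ u (Unique.cartesianProduct⁺ u (Unique.cartesianProduct⁺ u u)))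

  ∈-quads : ∀ {l x y z w} → x ∈ l → y ∈ l → z ∈ l → w ∈ l → (x , y , z , w) ∈ quads l
  ∈-quads {l} x∈ y∈ z∈ w∈ = subst ((_ , _ , _ , _) ∈_) (sym (quads-cartesianProduct l))
    (∈-cartesianProduct⁺ x∈ (∈-cartesianProduct⁺ y∈ (∈-cartesianProduct⁺ z∈ w∈)))

  range-unique : ∀ b → Unique (range b)
  range-unique b = Unique.map⁺ (λ {j} {k} eq → ℤ.+-injective (∙-cancelʳ (- + b) (+ j) (+ k) eq)) (Unique.upTo⁺ _)

  ∈-range : ∀ {b} x → ∣ x ∣ ≤ b → x ∈ range b
  ∈-range {b} (+ k) k≤b = subst (_∈ range b) shift (∈-map⁺ _ (∈-upTo⁺ (s≤s (ℕ.+-monoˡ-≤ b k≤b))))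
    where
    shift : + (k +ℕ b) - + b ≡ + k
    shift = trans (cong (_- + b) (ℤ.pos-+ k b)) (i+j-j≡i (+ k) (+ b))
      where
      i+j-j≡i : ∀ i j → i + j - j ≡ i
      i+j-j≡i = solve-∀
  ∈-range {b} -[1+ k ] k<b with d , refl ← ℕ.m≤n⇒∃[o]m+o≡n k<b =
    subst (_∈ range b) shift (∈-map⁺ _ (∈-upTo⁺ (s≤s (ℕ.≤-trans (ℕ.m≤n+m d (suc k)) (ℕ.m≤m+n b b)))))
    where
    shift : + d - + (suc k +ℕ d) ≡ -[1+ k ]
    shift = trans (cong (λ i → + d - i) (ℤ.pos-+ (suc k) d)) (j-[i+j]≡-i (+ suc k) (+ d))
      where
      j-[i+j]≡-i : ∀ i j → j - (i + j) ≡ - i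
      j-[i+j]≡-i = solve-∀

  weighted : (ℤ → ℤ) → ℕ → ℕ → ℕ → ℕ → ℤ⁴ → ℤ
  weighted g a b c d (x , y , z , w) = + a * g x + + b * g y + + c * g z + + d * g w

  square : ℤ → ℤ
  square x = x * x

  Sols : (ℤ → ℤ) → ℕ → ℕ → ℕ → ℕ → ℕ → Pred ℤ⁴ 0ℓ
  Sols g a b c d n q = weighted g a b c d q ≡ + n

  sols? : ∀ g a b c d n → Decidable (Sols g a b c d n)
  sols? g a b c d n q = weighted g a b c d q ℤ.≟ + n

  triℕ : ℤ → ℕ
  triℕ (+ k)     = k C 2
  triℕ -[1+ k ] = suc (suc k) C 2

  suc-C2 : ∀ k → suc k C 2 ≡ k +ℕ k C 2
  suc-C2 k = trans (sym (nCk+nC[k+1]≡[n+1]C[k+1] k 1)) (cong (_+ℕ k C 2) (nC1≡n k))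

  n≤[1+n]C2 : ∀ k → k ≤ suc k C 2
  n≤[1+n]C2 k = subst (k ≤_) (sym (suc-C2 k)) (ℕ.m≤m+n k _)

  n[n-1]≡2*nC2 : ∀ k → + k * (+ k - + 1) ≡ + 2 * + (k C 2)
  n[n-1]≡2*nC2 zero    = refl
  n[n-1]≡2*nC2 (suc k) = begin
    + suc k * (+ suc k - + 1)      ≡⟨ expand (+ k) ⟩
    + k * (+ k - + 1) + + 2 * + k  ≡⟨ cong (_+ + 2 * + k) (n[n-1]≡2*nC2 k) ⟩
    + 2 * + (k C 2) + + 2 * + k    ≡⟨ collect (+ k) (+ (k C 2)) ⟩
    + 2 * (+ k + + (k C 2))        ≡⟨ cong (+ 2 *_) (trans (cong +_ (suc-C2 k)) (ℤ.pos-+ k _)) ⟨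
    + 2 * + (suc k C 2)            ∎
    where
    open ≡-Reasoning
    expand : ∀ u → (+ 1 + u) * ((+ 1 + u) - + 1) ≡ u * (u - + 1) + + 2 * u
    expand = solve-∀
    collect : ∀ u v → + 2 * v + + 2 * u ≡ + 2 * (u + v)
    collect = solve-∀

  x[x-1]≡2*triℕ : ∀ x → x * (x - + 1) ≡ + 2 * + triℕ x
  x[x-1]≡2*triℕ (+ k)     = n[n-1]≡2*nC2 k
  x[x-1]≡2*triℕ -[1+ k ] = trans (negate (+ k)) (n[n-1]≡2*nC2 (suc (suc k)))
    where
    negate : ∀ u → (- (+ 1 + u)) * ((- (+ 1 + u)) - + 1) ≡ (+ 2 + u) * ((+ 2 + u) - + 1)
    negate = solve-∀

  tri≡triℕ : ∀ x → tri x ≡ + triℕ x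
  tri≡triℕ x = begin
    (x * (x - + 1)) div + 2     ≡⟨ cong (_div + 2) (trans (x[x-1]≡2*triℕ x) (sym (ℤ.pos-* 2 (triℕ x)))) ⟩
    + (2 *ℕ triℕ x) div + 2     ≡⟨ div-pos-is-/ℕ (+ (2 *ℕ triℕ x)) 2 ⟩
    + ((2 *ℕ triℕ x) ℕ./ 2)     ≡⟨ cong (λ n → + (n ℕ./ 2)) (ℕ.*-comm 2 (triℕ x)) ⟩
    + ((triℕ x *ℕ 2) ℕ./ 2)     ≡⟨ cong +_ (ℕ.m*n/n≡m (triℕ x) 2) ⟩
    + triℕ x                    ∎
    where open ≡-Reasoning

  ∣x∣≤1+triℕ : ∀ x → ∣ x ∣ ≤ suc (triℕ x)
  ∣x∣≤1+triℕ (+ zero)  = z≤n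
  ∣x∣≤1+triℕ (+ suc k) = s≤s (n≤[1+n]C2 k)
  ∣x∣≤1+triℕ -[1+ k ] = s≤s (ℕ.≤-trans (ℕ.n≤1+n k) (n≤[1+n]C2 (suc k)))

  weighted-pos : ∀ a b c d u v s r →
    + a * + u + + b * + v + + c * + s + + d * + r ≡ + (a *ℕ u +ℕ b *ℕ v +ℕ c *ℕ s +ℕ d *ℕ r)
  weighted-pos a b c d u v s r = sym
    (trans (ℤ.pos-+ _ (d *ℕ r)) (cong₂ _+_ (trans (ℤ.pos-+ _ (c *ℕ s)) (cong₂ _+_
      (trans (ℤ.pos-+ (a *ℕ u) _) (cong₂ _+_ (ℤ.pos-* a u) (ℤ.pos-* b v))) (ℤ.pos-* c s))) (ℤ.pos-* d r)))

  module _ (a b c d : ℕ) .{{_ : NonZero a}} .{{_ : NonZero b}} .{{_ : NonZero c}} .{{_ : NonZero d}} where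

    ≤-weighted-sum : ∀ {u v s r n} → a *ℕ u +ℕ b *ℕ v +ℕ c *ℕ s +ℕ d *ℕ r ≡ n → u ≤ n × v ≤ n × s ≤ n × r ≤ n
    ≤-weighted-sum {u} {v} {s} {r} refl =
      ℕ.≤-trans (ℕ.m≤n*m u a) (ℕ.≤-trans (ℕ.m≤m+n _ (b *ℕ v)) (≤-+c+d (a *ℕ u +ℕ b *ℕ v))) ,
      ℕ.≤-trans (ℕ.m≤n*m v b) (ℕ.≤-trans (ℕ.m≤n+m _ (a *ℕ u)) (≤-+c+d (a *ℕ u +ℕ b *ℕ v))) ,
      ℕ.≤-trans (ℕ.m≤n*m s c) (ℕ.≤-trans (ℕ.m≤n+m _ (a *ℕ u +ℕ b *ℕ v)) (ℕ.m≤m+n _ (d *ℕ r))) ,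
      ℕ.≤-trans (ℕ.m≤n*m r d) (ℕ.m≤n+m _ (a *ℕ u +ℕ b *ℕ v +ℕ c *ℕ s))
      where
      ≤-+c+d : ∀ k → k ≤ k +ℕ c *ℕ s +ℕ d *ℕ r
      ≤-+c+d k = ℕ.≤-trans (ℕ.m≤m+n k (c *ℕ s)) (ℕ.m≤m+n _ (d *ℕ r))

    weighted-Lists : ∀ {g} (f : ℤ → ℕ) → (∀ x → g x ≡ + f x) → ∀ {n β} → (∀ {x} → f x ≤ n → ∣ x ∣ ≤ β) →
      filter (sols? g a b c d n) (quads (range β)) Lists Sols g a b c d n
    weighted-Lists {g} f g≡f {n} {β} bound = filter-Lists (sols? g a b c d n) (quads-unique (range-unique β))
      λ {(x , y , z , w)} sol →
        let fx≤ , fy≤ , fz≤ , fw≤ = ≤-weighted-sum (ℤ.+-injective (trans (sym (weighted≡ x y z w)) sol))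
        in ∈-quads (∈-range x (bound fx≤)) (∈-range y (bound fy≤)) (∈-range z (bound fz≤)) (∈-range w (bound fw≤))
      where
      weighted≡ : ∀ x y z w → weighted g a b c d (x , y , z , w) ≡ + (a *ℕ f x +ℕ b *ℕ f y +ℕ c *ℕ f z +ℕ d *ℕ f w)
      weighted≡ x y z w = trans
        (cong₂ _+_ (cong₂ _+_ (cong₂ _+_ (cong (+ a *_) (g≡f x)) (cong (+ b *_) (g≡f y))) (cong (+ c *_) (g≡f z)))
                   (cong (+ d *_) (g≡f w)))
        (weighted-pos a b c d (f x) (f y) (f z) (f w))

    N-Lists : ∀ n → filter (sols? square a b c d n) (quads (range n)) Lists Sols square a b c d n
    N-Lists n = weighted-Lists (λ x → ∣ x ∣ *ℕ ∣ x ∣) square≡ (ℕ.≤-trans (n≤n*n _))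
      where
      square≡ : ∀ x → x * x ≡ + (∣ x ∣ *ℕ ∣ x ∣)
      square≡ (+ k)     = sym (ℤ.pos-* k k)
      square≡ -[1+ k ] = refl
      n≤n*n : ∀ k → k ≤ k *ℕ k
      n≤n*n zero    = z≤n
      n≤n*n (suc k) = ℕ.m≤m*n (suc k) (suc k)

    t-Lists : ∀ n → filter (sols? tri a b c d n) (quads (range (suc n))) Lists Sols tri a b c d n
    t-Lists n = weighted-Lists triℕ tri≡triℕ (λ {x} fx≤n → ℕ.≤-trans (∣x∣≤1+triℕ x) (s≤s fx≤n))

open Boxes

module Parity where

  open import Data.Integer using (_+_; _*_; _-_)
  open import Data.Integer.DivMod using (a≡a%ℕn+[a/ℕn]*n; n%ℕd<d; _/ℕ_; _%ℕ_)
  import Data.Integer.Properties as ℤ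
  open import Data.Integer.Tactic.RingSolver using (solve-∀)
  open import Data.Nat using (s≤s; _%_) renaming (_+_ to _+ℕ_; _*_ to _*ℕ_)
  import Data.Nat.DivMod as ℕ
  import Data.Nat.Properties as ℕ

  Even Odd SinglyEven : Pred ℤ 0ℓ
  Even x       = ∃[ k ] x ≡ + 2 * k
  Odd x        = ∃[ k ] x ≡ + 2 * k + + 1
  SinglyEven x = ∃[ k ] Odd k × x ≡ + 2 * k

  parity : ∀ x → Even x ⊎ Odd x
  parity x with x %ℕ 2 | n%ℕd<d x 2 | a≡a%ℕn+[a/ℕn]*n x 2
  ... | 0           | _             | x≡ = inj₁ (x /ℕ 2 , trans x≡ (even (x /ℕ 2)))
    where
    even : ∀ q → + 0 + q * + 2 ≡ + 2 * q
    even = solve-∀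
  ... | 1           | _             | x≡ = inj₂ (x /ℕ 2 , trans x≡ (odd (x /ℕ 2)))
    where
    odd : ∀ q → + 1 + q * + 2 ≡ + 2 * q + + 1
    odd = solve-∀
  ... | suc (suc _) | s≤s (s≤s ()) | _

  %2≡1⇒odd : ∀ a → a % 2 ≡ 1 → Odd (+ a)
  %2≡1⇒odd a a%2≡1 = + (a ℕ./ 2) , (begin
    + a                       ≡⟨ cong +_ (trans (ℕ.m≡m%n+[m/n]*n a 2) (cong (_+ℕ a ℕ./ 2 *ℕ 2) a%2≡1)) ⟩
    + 1 + + (a ℕ./ 2 *ℕ 2)    ≡⟨ cong (_+_ (+ 1)) (ℤ.pos-* (a ℕ./ 2) 2) ⟩
    + 1 + + (a ℕ./ 2) * + 2   ≡⟨ swap (+ (a ℕ./ 2)) ⟩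
    + 2 * + (a ℕ./ 2) + + 1   ∎)
    where
    open ≡-Reasoning
    swap : ∀ h → + 1 + h * + 2 ≡ + 2 * h + + 1
    swap = solve-∀

  2*i≢1 : ∀ i → + 2 * i ≢ + 1
  2*i≢1 (+ zero)   ()
  2*i≢1 (+ suc n)  eq = ℕ.m+1+n≢0 n (ℕ.suc-injective (ℤ.+-injective eq))
  2*i≢1 -[1+ n ] ()

  even⇒¬odd : ∀ {x} → Even x → ¬ Odd x
  even⇒¬odd (k , x≡2k) (l , x≡2l+1) = 2*i≢1 (k - l) (begin
    + 2 * (k - l)            ≡⟨ distrib k l ⟩
    + 2 * k - + 2 * l        ≡⟨ cong (_- + 2 * l) (trans (sym x≡2k) x≡2l+1) ⟩
    + 2 * l + + 1 - + 2 * l  ≡⟨ cancel l ⟩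
    + 1                      ∎)
    where
    open ≡-Reasoning
    distrib : ∀ k l → + 2 * (k - l) ≡ + 2 * k - + 2 * l
    distrib = solve-∀
    cancel : ∀ l → + 2 * l + + 1 - + 2 * l ≡ + 1
    cancel = solve-∀

  odd? : Decidable Odd
  odd? x with parity x
  ... | inj₁ even = no (even⇒¬odd even)
  ... | inj₂ odd  = yes odd

  ¬odd⇒even : ∀ {x} → ¬ Odd x → Even x
  ¬odd⇒even {x} ¬odd with parity x
  ... | inj₁ even = even
  ... | inj₂ odd  = ⊥-elim (¬odd odd)

  odd*odd : ∀ {x y} → Odd x → Odd y → Odd (x * y)
  odd*odd (i , refl) (j , refl) = + 2 * i * j + i + j , expand i j
    where
    expand : ∀ i j → (+ 2 * i + + 1) * (+ 2 * j + + 1) ≡ + 2 * (+ 2 * i * j + i + j) + + 1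
    expand = solve-∀

  odd+even : ∀ {x y} → Odd x → Even y → Odd (x + y)
  odd+even (i , refl) (j , refl) = i + j , collect i j
    where
    collect : ∀ i j → + 2 * i + + 1 + + 2 * j ≡ + 2 * (i + j) + + 1
    collect = solve-∀

  even+even : ∀ {x y} → Even x → Even y → Even (x + y)
  even+even (i , refl) (j , refl) = i + j , sym (ℤ.*-distribˡ-+ (+ 2) i j)

  even*ˡ : ∀ {x} → Even x → ∀ y → Even (x * y)
  even*ˡ (k , refl) y = k * y , ℤ.*-assoc (+ 2) k y

  even*ʳ : ∀ x {y} → Even y → Even (x * y)
  even*ʳ x (k , refl) = x * k , swap x k
    where
    swap : ∀ x k → x * (+ 2 * k) ≡ + 2 * (x * k)
    swap = solve-∀

  even-2* : ∀ n → Even (+ (2 *ℕ n))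
  even-2* n = + n , ℤ.pos-* 2 n

  even-4* : ∀ n → Even (+ (4 *ℕ n))
  even-4* n = + (2 *ℕ n) , trans (cong +_ (ℕ.*-assoc 2 2 n)) (ℤ.pos-* 2 (2 *ℕ n))

  2n+2m+a-odd : ∀ n m {a} → Odd (+ a) → Odd (+ (2 *ℕ n +ℕ 2 *ℕ m +ℕ a))
  2n+2m+a-odd n m {a} (α , a≡2α+1) = + n + + m + α , (begin
    + (2 *ℕ n) + + (2 *ℕ m) + + a            ≡⟨ cong₂ _+_ (cong₂ _+_ (ℤ.pos-* 2 n) (ℤ.pos-* 2 m)) a≡2α+1 ⟩
    + 2 * + n + + 2 * + m + (+ 2 * α + + 1)  ≡⟨ collect (+ n) (+ m) α ⟩
    + 2 * (+ n + + m + α) + + 1              ∎)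
    where
    open ≡-Reasoning
    collect : ∀ n m α → + 2 * n + + 2 * m + (+ 2 * α + + 1) ≡ + 2 * (n + m + α) + + 1
    collect = solve-∀

open Parity

module OddSubstitution where

  open import Data.Integer using (_+_; _*_; _-_; NonZero)
  import Data.Integer.Properties as ℤ
  open import Algebra.Properties.AbelianGroup ℤ.+-0-abelianGroup using (∙-cancelʳ)
  open import Data.Integer.Tactic.RingSolver using (solve-∀)
  open import Data.Nat using () renaming (_+_ to _+ℕ_; _*_ to _*ℕ_)

  ≡⁴ : ∀ {x y z w x′ y′ z′ w′ : ℤ} → x ≡ x′ → y ≡ y′ → z ≡ z′ → w ≡ w′ →
    (x , y , z , w) ≡ (x′ , y′ , z′ , w′)
  ≡⁴ refl refl refl refl = refl

  map⁴ : (ℤ → ℤ) → ℤ⁴ → ℤ⁴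
  map⁴ f (x , y , z , w) = f x , f y , f z , f w

  scale⁴ : ℤ → ℤ⁴ → ℤ⁴
  scale⁴ k = map⁴ (k *_)

  scale⁴-injective : ∀ k .{{_ : NonZero k}} → Injective _≡_ _≡_ (scale⁴ k)
  scale⁴-injective k eq = ≡⁴ (cancel (cong proj₁ eq)) (cancel (cong (proj₁ ∘ proj₂) eq))
    (cancel (cong (proj₁ ∘ proj₂ ∘ proj₂) eq)) (cancel (cong (proj₂ ∘ proj₂ ∘ proj₂) eq))
    where
    cancel : ∀ {i j} → k * i ≡ k * j → i ≡ j
    cancel = ℤ.*-cancelˡ-≡ k _ _

  scaled-inverse⇒injective : ∀ {f : ℤ⁴ → ℤ⁴} (g : ℤ⁴ → ℤ⁴) k .{{_ : NonZero k}} →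
    (∀ q → g (f q) ≡ scale⁴ k q) → Injective _≡_ _≡_ f
  scaled-inverse⇒injective g k inverse {q} {q′} eq =
    scale⁴-injective k (trans (sym (inverse q)) (trans (cong g eq) (inverse q′)))

  AllOdd : Pred ℤ⁴ 0ℓ
  AllOdd (x , y , z , w) = Odd x × Odd y × Odd z × Odd w

  τ : ℤ⁴ → ℤ⁴
  τ = map⁴ (λ x → + 2 * x - + 1)

  [2x-1]²≡8*tri+1 : ∀ x → square (+ 2 * x - + 1) ≡ + 8 * tri x + + 1
  [2x-1]²≡8*tri+1 x = begin
    (+ 2 * x - + 1) * (+ 2 * x - + 1)  ≡⟨ expand x ⟩
    + 4 * (x * (x - + 1)) + + 1        ≡⟨ cong (λ i → + 4 * i + + 1) (x[x-1]≡2*triℕ x) ⟩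
    + 4 * (+ 2 * + triℕ x) + + 1       ≡⟨ cong (λ i → + 4 * (+ 2 * i) + + 1) (tri≡triℕ x) ⟨
    + 4 * (+ 2 * tri x) + + 1          ≡⟨ cong (_+ + 1) (ℤ.*-assoc (+ 4) (+ 2) (tri x)) ⟨
    + 8 * tri x + + 1                  ∎
    where
    open ≡-Reasoning
    expand : ∀ x → (+ 2 * x - + 1) * (+ 2 * x - + 1) ≡ + 4 * (x * (x - + 1)) + + 1
    expand = solve-∀

  weighted-τ : ∀ a b c d q → weighted square a b c d (τ q) ≡ + 8 * weighted tri a b c d q + + (a +ℕ b +ℕ c +ℕ d)
  weighted-τ a b c d (x , y , z , w) = begin
    weighted square a b c d (τ (x , y , z , w))
      ≡⟨ cong₂ _+_ (cong₂ _+_ (cong₂ _+_ (cong (+ a *_) ([2x-1]²≡8*tri+1 x)) (cong (+ b *_) ([2x-1]²≡8*tri+1 y)))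
                              (cong (+ c *_) ([2x-1]²≡8*tri+1 z))) (cong (+ d *_) ([2x-1]²≡8*tri+1 w)) ⟩
    + a * (+ 8 * tri x + + 1) + + b * (+ 8 * tri y + + 1) + + c * (+ 8 * tri z + + 1) + + d * (+ 8 * tri w + + 1)
      ≡⟨ collect (+ a) (+ b) (+ c) (+ d) (tri x) (tri y) (tri z) (tri w) ⟩
    + 8 * weighted tri a b c d (x , y , z , w) + + (a +ℕ b +ℕ c +ℕ d) ∎
    where
    open ≡-Reasoning
    collect : ∀ A B C D X Y Z W → A * (+ 8 * X + + 1) + B * (+ 8 * Y + + 1) + C * (+ 8 * Z + + 1) + D * (+ 8 * W + + 1)
                                ≡ + 8 * (A * X + B * Y + C * Z + D * W) + (A + B + C + D)
    collect = solve-∀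

  τ-bijection : ∀ a b c d n →
    BijectionOn τ (Sols tri a b c d n) (Sols square a b c d (8 *ℕ n +ℕ (a +ℕ b +ℕ c +ℕ d)) ∩ AllOdd)
  τ-bijection a b c d n = record
    { injective = scaled-inverse⇒injective (map⁴ (_+ + 1)) (+ 2) λ (x , y , z , w) → ≡⁴ (undo x) (undo y) (undo z) (undo w)
    ; mapsTo    = λ {(x , y , z , w)} sol → trans (weighted-τ a b c d (x , y , z , w)) (8*-+s sol) ,
                    (x - + 1 , odd x) , (y - + 1 , odd y) , (z - + 1 , odd z) , (w - + 1 , odd w)
    ; onto      = λ (sol , (i , x≡) , (j , y≡) , (k , z≡) , (l , w≡)) →
                    let pre    = map⁴ (_+ + 1) (i , j , k , l)
                        τpre≡q = ≡⁴ (trans (shift i) (sym x≡)) (trans (shift j) (sym y≡))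
                                    (trans (shift k) (sym z≡)) (trans (shift l) (sym w≡))
                    in pre , 8*-+s-injective (trans (sym (weighted-τ a b c d pre))
                                                   (trans (cong (weighted square a b c d) τpre≡q) sol)) , τpre≡q
    }
    where
    s : ℕ
    s = a +ℕ b +ℕ c +ℕ d
    8*-+s : ∀ {i} → i ≡ + n → + 8 * i + + s ≡ + (8 *ℕ n +ℕ s)
    8*-+s refl = cong (_+ + s) (sym (ℤ.pos-* 8 n))
    8*-+s-injective : ∀ {i} → + 8 * i + + s ≡ + (8 *ℕ n +ℕ s) → i ≡ + n
    8*-+s-injective eq = ℤ.*-cancelˡ-≡ (+ 8) _ _ (∙-cancelʳ (+ s) _ _ (trans eq (sym (8*-+s refl))))
    undo : ∀ x → + 2 * x - + 1 + + 1 ≡ + 2 * x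
    undo = solve-∀
    odd : ∀ x → + 2 * x - + 1 ≡ + 2 * (x - + 1) + + 1
    odd = solve-∀
    shift : ∀ i → + 2 * (i + + 1) - + 1 ≡ + 2 * i + + 1
    shift = solve-∀

open OddSubstitution

module TernaryForm where

  open import Data.Integer using (_+_; _*_; _-_)
  import Data.Integer.Properties as ℤ
  open import Data.Integer.Tactic.RingSolver using (solve-∀)
  open import Data.Nat using () renaming (_*_ to _*ℕ_)

  first second last : ℤ⁴ → ℤ
  first  (x , _ , _ , _) = x
  second (_ , y , _ , _) = y
  last   (_ , _ , _ , w) = w

  ternary : ℤ → ℤ → ℤ → ℤ
  ternary x y z = x * x + y * y + + 2 * (z * z)

  ternary-even : ∀ x y z → Even (x + y) → Even (ternary x y z)
  ternary-even x y z (s , x+y≡2s) = + 2 * s * s - + 2 * s * y + y * y + z * z , (begin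
    ternary x y z              ≡⟨ cong (λ x → ternary x y z) (trans (split x y) (cong (_- y) x+y≡2s)) ⟩
    ternary (+ 2 * s - y) y z  ≡⟨ expand s y z ⟩
    + 2 * (+ 2 * s * s - + 2 * s * y + y * y + z * z) ∎)
    where
    open ≡-Reasoning
    split : ∀ x y → x ≡ x + y - y
    split = solve-∀
    expand : ∀ s y z → (+ 2 * s - y) * (+ 2 * s - y) + y * y + + 2 * (z * z)
                     ≡ + 2 * (+ 2 * s * s - + 2 * s * y + y * y + z * z)
    expand = solve-∀

  ternary-mod4 : ∀ x y z →
    (Even x × Even y × Even z) ⊎ (Odd x × Odd y × Odd z) ⊎ Odd (ternary x y z) ⊎ SinglyEven (ternary x y z)
  ternary-mod4 x y z with parity x | parity y | parity z
  ... | inj₁ ex           | inj₁ ey           | inj₁ ez           = inj₁ (ex , ey , ez)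
  ... | inj₂ ox           | inj₂ oy           | inj₂ oz           = inj₂ (inj₁ (ox , oy , oz))
  ... | inj₁ (i , refl) | inj₂ (j , refl) | _                 =
    inj₂ (inj₂ (inj₁ (+ 2 * i * i + + 2 * j * j + + 2 * j + z * z , even-odd i j z)))
    where
    even-odd : ∀ i j z → + 2 * i * (+ 2 * i) + (+ 2 * j + + 1) * (+ 2 * j + + 1) + + 2 * (z * z)
                       ≡ + 2 * (+ 2 * i * i + + 2 * j * j + + 2 * j + z * z) + + 1
    even-odd = solve-∀
  ... | inj₂ (i , refl) | inj₁ (j , refl) | _                 =
    inj₂ (inj₂ (inj₁ (+ 2 * i * i + + 2 * i + + 2 * j * j + z * z , odd-even i j z)))
    where
    odd-even : ∀ i j z → (+ 2 * i + + 1) * (+ 2 * i + + 1) + + 2 * j * (+ 2 * j) + + 2 * (z * z)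
                       ≡ + 2 * (+ 2 * i * i + + 2 * i + + 2 * j * j + z * z) + + 1
    odd-even = solve-∀
  ... | inj₂ (i , refl) | inj₂ (j , refl) | inj₁ (k , refl) =
    inj₂ (inj₂ (inj₂ (_ , (i * i + i + j * j + j + + 2 * k * k , refl) , odd-odd-even i j k)))
    where
    odd-odd-even : ∀ i j k → (+ 2 * i + + 1) * (+ 2 * i + + 1) + (+ 2 * j + + 1) * (+ 2 * j + + 1) + + 2 * (+ 2 * k * (+ 2 * k))
                           ≡ + 2 * (+ 2 * (i * i + i + j * j + j + + 2 * k * k) + + 1)
    odd-odd-even = solve-∀
  ... | inj₁ (i , refl) | inj₁ (j , refl) | inj₂ (k , refl) =
    inj₂ (inj₂ (inj₂ (_ , (i * i + j * j + + 2 * k * k + + 2 * k , refl) , even-even-odd i j k)))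
    where
    even-even-odd : ∀ i j k → + 2 * i * (+ 2 * i) + + 2 * j * (+ 2 * j) + + 2 * ((+ 2 * k + + 1) * (+ 2 * k + + 1))
                            ≡ + 2 * (+ 2 * (i * i + j * j + + 2 * k * k + + 2 * k) + + 1)
    even-even-odd = solve-∀

  form-ternary : ∀ a d x y z w → weighted square a a (2 *ℕ a) d (x , y , z , w) ≡ + a * ternary x y z + + d * (w * w)
  form-ternary a d x y z w =
    trans (cong (λ c → + a * (x * x) + + a * (y * y) + c * (z * z) + + d * (w * w)) (ℤ.pos-* 2 a))
          (regroup (+ a) (+ d) x y z w)
    where
    regroup : ∀ A D x y z w → A * (x * x) + A * (y * y) + + 2 * A * (z * z) + D * (w * w)
                            ≡ A * (x * x + y * y + + 2 * (z * z)) + D * (w * w)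
    regroup = solve-∀

  same-parity : ∀ a → Odd (+ a) → ∀ {d K} x y z w → Sols square a a (2 *ℕ a) (4 *ℕ d) (4 *ℕ K) (x , y , z , w) →
    (Even x × Even y × Even z) ⊎ (Odd x × Odd y × Odd z)
  same-parity a a-odd {d} {K} x y z w sol with ternary-mod4 x y z
  ... | inj₁ evens               = inj₁ evens
  ... | inj₂ (inj₁ odds)         = inj₂ odds
  ... | inj₂ (inj₂ (inj₁ odd-t)) = ⊥-elim (even⇒¬odd (even-4* K)
    (subst Odd (trans (sym (form-ternary a (4 *ℕ d) x y z w)) sol)
      (odd+even (odd*odd a-odd odd-t) (even*ˡ (even-4* d) (w * w)))))
  ... | inj₂ (inj₂ (inj₂ (u , odd-u , t≡2u))) = ⊥-elim (even⇒¬odd (even-2* K)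
    (subst Odd half-sum≡2K (odd+even (odd*odd a-odd odd-u) (even*ˡ (even-2* d) (w * w)))))
    where
    half-sum≡2K : + a * u + + (2 *ℕ d) * (w * w) ≡ + (2 *ℕ K)
    half-sum≡2K = ℤ.*-cancelˡ-≡ (+ 2) _ _ (begin
      + 2 * (+ a * u + + (2 *ℕ d) * (w * w))         ≡⟨ factor (+ a) u (+ (2 *ℕ d)) (w * w) ⟩
      + a * (+ 2 * u) + + 2 * + (2 *ℕ d) * (w * w)  ≡⟨ cong₂ (λ t c → + a * t + c * (w * w)) t≡2u (proj₂ (even-4* d)) ⟨
      + a * ternary x y z + + (4 *ℕ d) * (w * w)    ≡⟨ trans (sym (form-ternary a (4 *ℕ d) x y z w)) sol ⟩
      + (4 *ℕ K)                                    ≡⟨ proj₂ (even-4* K) ⟩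
      + 2 * + (2 *ℕ K)                              ∎)
      where
      open ≡-Reasoning
      factor : ∀ A u D W → + 2 * (A * u + D * W) ≡ A * (+ 2 * u) + + 2 * D * W
      factor = solve-∀

  first+second-odd : ∀ a m K → Odd (+ K) → ∀ x y z w → Sols square a a (2 *ℕ a) (2 *ℕ m) K (x , y , z , w) → Odd (x + y)
  first+second-odd a m K K-odd x y z w sol with parity (x + y)
  ... | inj₂ odd  = odd
  ... | inj₁ even = ⊥-elim (even⇒¬odd
    (subst Even (trans (sym (form-ternary a (2 *ℕ m) x y z w)) sol)
      (even+even (even*ʳ (+ a) (ternary-even x y z even)) (even*ˡ (even-2* m) (w * w))))
    K-odd)

open TernaryForm

module TernaryMaps where

  open import Data.Integer using (_+_; _*_; _-_)
  open import Data.Integer.Divisibility.Signed using (_∣_; _∣?_)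
  import Data.Integer.Properties as ℤ
  open import Data.Integer.Tactic.RingSolver using (solve-∀)
  open import Data.Nat using () renaming (_*_ to _*ℕ_)

  ℤ³ : Set
  ℤ³ = ℤ × ℤ × ℤ

  ternary³ : ℤ³ → ℤ
  ternary³ (x , y , z) = ternary x y z

  onTernary : (ℤ³ → ℤ³) → ℤ⁴ → ℤ⁴
  onTernary t (x , y , z , w) = proj₁ (t (x , y , z)) , proj₁ (proj₂ (t (x , y , z))) , proj₂ (proj₂ (t (x , y , z))) , w

  Ternary×4 : (ℤ³ → ℤ³) → Set
  Ternary×4 t = ∀ p → ternary³ (t p) ≡ + 4 * ternary³ p

  form-×4 : ∀ a d t → Ternary×4 t → ∀ q →
    weighted square a a (2 *ℕ a) (4 *ℕ d) (onTernary t q) ≡ + 4 * weighted square a a (2 *ℕ a) d q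
  form-×4 a d t t-×4 (x , y , z , w) = begin
    weighted square a a (2 *ℕ a) (4 *ℕ d) (X , Y , Z , w)  ≡⟨ form-ternary a (4 *ℕ d) X Y Z w ⟩
    + a * ternary X Y Z + + (4 *ℕ d) * (w * w)
      ≡⟨ cong₂ (λ t c → + a * t + c * (w * w)) (t-×4 (x , y , z)) (ℤ.pos-* 4 d) ⟩
    + a * (+ 4 * ternary x y z) + + 4 * + d * (w * w)      ≡⟨ factor (+ a) (ternary x y z) (+ d) (w * w) ⟩
    + 4 * (+ a * ternary x y z + + d * (w * w))            ≡⟨ cong (+ 4 *_) (form-ternary a d x y z w) ⟨
    + 4 * weighted square a a (2 *ℕ a) d (x , y , z , w)   ∎
    where
    open ≡-Reasoning
    X Y Z : ℤ
    X = proj₁ (t (x , y , z))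
    Y = proj₁ (proj₂ (t (x , y , z)))
    Z = proj₂ (proj₂ (t (x , y , z)))
    factor : ∀ A t D W → A * (+ 4 * t) + + 4 * D * W ≡ + 4 * (A * t + D * W)
    factor = solve-∀

  ε³ φ₀³ φ₁³ : ℤ³ → ℤ³
  ε³  (x , y , z) = + 2 * x , + 2 * y , + 2 * z
  φ₀³ (x , y , z) = x + y + + 2 * z , x + y - + 2 * z , x - y
  φ₁³ (x , y , z) = x + y + + 2 * z , + 2 * z - x - y , x - y

  ε³-×4 : Ternary×4 ε³
  ε³-×4 (x , y , z) = expand x y z
    where
    expand : ∀ x y z → + 2 * x * (+ 2 * x) + + 2 * y * (+ 2 * y) + + 2 * (+ 2 * z * (+ 2 * z))
                     ≡ + 4 * (x * x + y * y + + 2 * (z * z))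
    expand = solve-∀

  φ₀³-×4 : Ternary×4 φ₀³
  φ₀³-×4 (x , y , z) = expand x y z
    where
    expand : ∀ x y z → (x + y + + 2 * z) * (x + y + + 2 * z) + (x + y - + 2 * z) * (x + y - + 2 * z) + + 2 * ((x - y) * (x - y))
                     ≡ + 4 * (x * x + y * y + + 2 * (z * z))
    expand = solve-∀

  φ₁³-×4 : Ternary×4 φ₁³
  φ₁³-×4 (x , y , z) = expand x y z
    where
    expand : ∀ x y z → (x + y + + 2 * z) * (x + y + + 2 * z) + (+ 2 * z - x - y) * (+ 2 * z - x - y) + + 2 * ((x - y) * (x - y))
                     ≡ + 4 * (x * x + y * y + + 2 * (z * z))
    expand = solve-∀

  ε φ₀ φ₁ ω : ℤ⁴ → ℤ⁴
  ε  = onTernary ε³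
  φ₀ = onTernary φ₀³
  φ₁ = onTernary φ₁³
  ω (x , y , z , w) = x , y , z , + 2 * w

  ε-injective : Injective _≡_ _≡_ ε
  ε-injective = scaled-inverse⇒injective (λ (X , Y , Z , W) → X , Y , Z , + 2 * W) (+ 2) (λ _ → refl)

  ω-injective : Injective _≡_ _≡_ ω
  ω-injective = scaled-inverse⇒injective (λ (X , Y , Z , W) → + 2 * X , + 2 * Y , + 2 * Z , W) (+ 2) (λ _ → refl)

  φ₀-injective : Injective _≡_ _≡_ φ₀
  φ₀-injective = scaled-inverse⇒injective (λ (X , Y , Z , W) → X + Y + + 2 * Z , X + Y - + 2 * Z , X - Y , + 4 * W) (+ 4)
    λ (x , y , z , w) → ≡⁴ (inverse₁ x y z) (inverse₂ x y z) (inverse₃ x y z) refl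
    where
    inverse₁ : ∀ x y z → x + y + + 2 * z + (x + y - + 2 * z) + + 2 * (x - y) ≡ + 4 * x
    inverse₁ = solve-∀
    inverse₂ : ∀ x y z → x + y + + 2 * z + (x + y - + 2 * z) - + 2 * (x - y) ≡ + 4 * y
    inverse₂ = solve-∀
    inverse₃ : ∀ x y z → x + y + + 2 * z - (x + y - + 2 * z) ≡ + 4 * z
    inverse₃ = solve-∀

  φ₁-injective : Injective _≡_ _≡_ φ₁
  φ₁-injective = scaled-inverse⇒injective (λ (X , Y , Z , W) → X - Y + + 2 * Z , X - Y - + 2 * Z , X + Y , + 4 * W) (+ 4)
    λ (x , y , z , w) → ≡⁴ (inverse₁ x y z) (inverse₂ x y z) (inverse₃ x y z) refl
    where
    inverse₁ : ∀ x y z → x + y + + 2 * z - (+ 2 * z - x - y) + + 2 * (x - y) ≡ + 4 * x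
    inverse₁ = solve-∀
    inverse₂ : ∀ x y z → x + y + + 2 * z - (+ 2 * z - x - y) - + 2 * (x - y) ≡ + 4 * y
    inverse₂ = solve-∀
    inverse₃ : ∀ x y z → x + y + + 2 * z + (+ 2 * z - x - y) ≡ + 4 * z
    inverse₃ = solve-∀

  first≡second-mod4 : Pred ℤ⁴ 0ℓ
  first≡second-mod4 q = + 4 ∣ first q - second q

  first≡second-mod4? : Decidable first≡second-mod4
  first≡second-mod4? q = + 4 ∣? (first q - second q)

  first-odd? : Decidable (Odd ∘ first)
  first-odd? = odd? ∘ first

  last-odd? : Decidable (Odd ∘ last)
  last-odd? = odd? ∘ last

open TernaryMaps

module Bijections where

  open import Data.Integer using (_+_; _*_; _-_)
  open import Data.Integer.Divisibility.Signed using (divides)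
  import Data.Integer.Properties as ℤ
  open import Data.Integer.Tactic.RingSolver using (solve-∀)
  open import Data.Nat using () renaming (_*_ to _*ℕ_)

  ω-bijection : ∀ a b c d n → BijectionOn ω (Sols square a b c (4 *ℕ d) n) (Sols square a b c d n ∩ ∁ (Odd ∘ last))
  ω-bijection a b c d n = record
    { injective = ω-injective
    ; mapsTo    = λ {(x , y , z , w)} sol → trans (sym (form-ω x y z w)) sol , even⇒¬odd (w , refl)
    ; onto      = onto
    }
    where
    form-ω : ∀ x y z w → weighted square a b c (4 *ℕ d) (x , y , z , w) ≡ weighted square a b c d (ω (x , y , z , w))
    form-ω x y z w = cong (_+_ (+ a * (x * x) + + b * (y * y) + + c * (z * z)))
      (trans (cong (_* (w * w)) (ℤ.pos-* 4 d)) (regroup (+ d) w))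
      where
      regroup : ∀ D w → + 4 * D * (w * w) ≡ D * (+ 2 * w * (+ 2 * w))
      regroup = solve-∀
    onto : ∀ {q} → (Sols square a b c d n ∩ ∁ (Odd ∘ last)) q → ∃[ p ] Sols square a b c (4 *ℕ d) n p × ω p ≡ q
    onto {X , Y , Z , W} (sol , W-not-odd) with ¬odd⇒even W-not-odd
    ... | k , refl = (X , Y , Z , k) , trans (form-ω X Y Z k) sol , refl

  module _ (a d K : ℕ) (a-odd : Odd (+ a)) where

    private
      Sols-K Sols-4K : Pred ℤ⁴ 0ℓ
      Sols-K  = Sols square a a (2 *ℕ a) d K
      Sols-4K = Sols square a a (2 *ℕ a) (4 *ℕ d) (4 *ℕ K)

      ×4 : ∀ t → Ternary×4 t → ∀ {q} → Sols-K q → Sols-4K (onTernary t q)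
      ×4 t t-×4 {q} sol = trans (form-×4 a d t t-×4 q) (trans (cong (+ 4 *_) sol) (sym (ℤ.pos-* 4 K)))

      ÷4 : ∀ t → Ternary×4 t → ∀ {q} → Sols-4K (onTernary t q) → Sols-K q
      ÷4 t t-×4 {q} sol = ℤ.*-cancelˡ-≡ (+ 4) _ _ (trans (sym (form-×4 a d t t-×4 q)) (trans sol (ℤ.pos-* 4 K)))

    ε-onto : ∀ {q} → (Sols-4K ∩ ∁ (Odd ∘ first)) q → ∃[ p ] Sols-K p × ε p ≡ q
    ε-onto {X , Y , Z , W} (sol , X-not-odd) with same-parity a a-odd {d} {K} X Y Z W sol
    ... | inj₁ ((i , refl) , (j , refl) , (k , refl)) = (i , j , k , W) , ÷4 ε³ ε³-×4 {i , j , k , W} sol , refl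
    ... | inj₂ (X-odd , _)                             = ⊥-elim (X-not-odd X-odd)

    ε-bijection : BijectionOn ε Sols-K (Sols-4K ∩ ∁ (Odd ∘ first))
    ε-bijection = record
      { injective = ε-injective
      ; mapsTo    = λ {(x , y , z , w)} sol → ×4 ε³ ε³-×4 {x , y , z , w} sol , even⇒¬odd (x , refl)
      ; onto      = ε-onto
      }

    module _ (x+y-odd : ∀ x y z w → Sols-K (x , y , z , w) → Odd (x + y)) where

      private
        first-odd : ∀ x y z w → Sols-K (x , y , z , w) → Odd (x + y + + 2 * z)
        first-odd x y z w sol with s , x+y≡2s+1 ← x+y-odd x y z w sol =
          s + z , trans (cong (_+ + 2 * z) x+y≡2s+1) (collect s z)
          where
          collect : ∀ s z → + 2 * s + + 1 + + 2 * z ≡ + 2 * (s + z) + + 1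
          collect = solve-∀

      φ₀-onto : ∀ {q} → ((Sols-4K ∩ Odd ∘ first) ∩ first≡second-mod4) q → ∃[ p ] Sols-K p × φ₀ p ≡ q
      φ₀-onto {X , Y , Z , W} ((sol , X-odd) , divides e X-Y≡4e) with same-parity a a-odd {d} {K} X Y Z W sol
      ... | inj₁ (X-even , _)                   = ⊥-elim (even⇒¬odd X-even X-odd)
      ... | inj₂ (_ , (j , refl) , (k , refl)) =
        pre , ÷4 φ₀³ φ₀³-×4 {pre} (subst Sols-4K (sym φ₀pre≡q) sol) , φ₀pre≡q
        where
        pre : ℤ⁴
        pre = j + e + k + + 1 , j + e - k , e , W
        first≡ : (j + e + k + + 1) + (j + e - k) + + 2 * e ≡ X
        first≡ = begin
          (j + e + k + + 1) + (j + e - k) + + 2 * e  ≡⟨ regroup j e k ⟩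
          e * + 4 + (+ 2 * j + + 1)                 ≡⟨ cong (_+ (+ 2 * j + + 1)) X-Y≡4e ⟨
          X - (+ 2 * j + + 1) + (+ 2 * j + + 1)     ≡⟨ cancel X (+ 2 * j + + 1) ⟩
          X                                         ∎
          where
          open ≡-Reasoning
          regroup : ∀ j e k → (j + e + k + + 1) + (j + e - k) + + 2 * e ≡ e * + 4 + (+ 2 * j + + 1)
          regroup = solve-∀
          cancel : ∀ X Y → X - Y + Y ≡ X
          cancel = solve-∀
        second≡ : ∀ j e k → (j + e + k + + 1) + (j + e - k) - + 2 * e ≡ + 2 * j + + 1
        second≡ = solve-∀
        third≡ : ∀ j e k → (j + e + k + + 1) - (j + e - k) ≡ + 2 * k + + 1
        third≡ = solve-∀
        φ₀pre≡q : φ₀ pre ≡ (X , + 2 * j + + 1 , + 2 * k + + 1 , W)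
        φ₀pre≡q = ≡⁴ first≡ (second≡ j e k) (third≡ j e k) refl

      φ₀-bijection : BijectionOn φ₀ Sols-K ((Sols-4K ∩ Odd ∘ first) ∩ first≡second-mod4)
      φ₀-bijection = record
        { injective = φ₀-injective
        ; mapsTo    = λ {(x , y , z , w)} sol → (×4 φ₀³ φ₀³-×4 {x , y , z , w} sol , first-odd x y z w sol) ,
                        divides z (difference x y z)
        ; onto      = φ₀-onto
        }
        where
        difference : ∀ x y z → x + y + + 2 * z - (x + y - + 2 * z) ≡ z * + 4
        difference = solve-∀

      φ₁-onto : ∀ {q} → ((Sols-4K ∩ Odd ∘ first) ∩ ∁ first≡second-mod4) q → ∃[ p ] Sols-K p × φ₁ p ≡ q
      φ₁-onto {X , Y , Z , W} ((sol , X-odd) , X≢Y) with same-parity a a-odd {d} {K} X Y Z W sol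
      ... | inj₁ (X-even , _)                                = ⊥-elim (even⇒¬odd X-even X-odd)
      ... | inj₂ ((i , refl) , (j , refl) , (k , refl)) with parity (i - j)
      ...   | inj₁ (e , i-j≡2e) = ⊥-elim (X≢Y (divides e (begin
        + 2 * i + + 1 - (+ 2 * j + + 1)  ≡⟨ halve i j ⟩
        + 2 * (i - j)                   ≡⟨ cong (+ 2 *_) i-j≡2e ⟩
        + 2 * (+ 2 * e)                 ≡⟨ quadruple e ⟩
        e * + 4                         ∎)))
        where
        open ≡-Reasoning
        halve : ∀ i j → + 2 * i + + 1 - (+ 2 * j + + 1) ≡ + 2 * (i - j)
        halve = solve-∀
        quadruple : ∀ e → + 2 * (+ 2 * e) ≡ e * + 4
        quadruple = solve-∀
      ...   | inj₂ (e , i-j≡2e+1) =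
        pre , ÷4 φ₁³ φ₁³-×4 {pre} (subst Sols-4K (sym φ₁pre≡q) sol) , φ₁pre≡q
        where
        pre : ℤ⁴
        pre = e + k + + 1 , e - k , j + e + + 1 , W
        first≡ : (e + k + + 1) + (e - k) + + 2 * (j + e + + 1) ≡ + 2 * i + + 1
        first≡ = begin
          (e + k + + 1) + (e - k) + + 2 * (j + e + + 1)  ≡⟨ regroup j e k ⟩
          + 2 * ((+ 2 * e + + 1) + j) + + 1              ≡⟨ cong (λ u → + 2 * (u + j) + + 1) i-j≡2e+1 ⟨
          + 2 * ((i - j) + j) + + 1                      ≡⟨ cancel i j ⟩
          + 2 * i + + 1                                  ∎
          where
          open ≡-Reasoning
          regroup : ∀ j e k → (e + k + + 1) + (e - k) + + 2 * (j + e + + 1) ≡ + 2 * ((+ 2 * e + + 1) + j) + + 1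
          regroup = solve-∀
          cancel : ∀ i j → + 2 * ((i - j) + j) + + 1 ≡ + 2 * i + + 1
          cancel = solve-∀
        second≡ : ∀ j e k → + 2 * (j + e + + 1) - (e + k + + 1) - (e - k) ≡ + 2 * j + + 1
        second≡ = solve-∀
        third≡ : ∀ e k → (e + k + + 1) - (e - k) ≡ + 2 * k + + 1
        third≡ = solve-∀
        φ₁pre≡q : φ₁ pre ≡ (+ 2 * i + + 1 , + 2 * j + + 1 , + 2 * k + + 1 , W)
        φ₁pre≡q = ≡⁴ first≡ (second≡ j e k) (third≡ e k) refl

      φ₁-bijection : BijectionOn φ₁ Sols-K ((Sols-4K ∩ Odd ∘ first) ∩ ∁ first≡second-mod4)
      φ₁-bijection = record
        { injective = φ₁-injective
        ; mapsTo    = λ {(x , y , z , w)} sol → (×4 φ₁³ φ₁³-×4 {x , y , z , w} sol , first-odd x y z w sol) ,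
                        λ (divides e X-Y≡4e) → even⇒¬odd (e , halve (trans (difference x y z) X-Y≡4e)) (x+y-odd x y z w sol)
        ; onto      = φ₁-onto
        }
        where
        difference : ∀ x y z → + 2 * (x + y) ≡ x + y + + 2 * z - (+ 2 * z - x - y)
        difference = solve-∀
        halve : ∀ {s e} → + 2 * s ≡ e * + 4 → s ≡ + 2 * e
        halve {s} {e} eq = ℤ.*-cancelˡ-≡ (+ 2) s (+ 2 * e) (trans eq (quadruple e))
          where
          quadruple : ∀ e → e * + 4 ≡ + 2 * (+ 2 * e)
          quadruple = solve-∀

open Bijections

module Counts where

  open import Data.List.Properties using (length-map)
  open import Data.Nat using (_+_; _*_; NonZero)
  import Data.Nat.Properties as ℕ
  open import Data.Nat.Tactic.RingSolver using (solve-∀)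

  module _ (a m : ℕ) .{{_ : NonZero a}} .{{_ : NonZero m}} (a-odd : Odd (+ a)) where

    private
      instance
        2a≢0 : NonZero (2 * a)
        2a≢0 = ℕ.m*n≢0 2 a
        2m≢0 : NonZero (2 * m)
        2m≢0 = ℕ.m*n≢0 2 m
        4[2m]≢0 : NonZero (4 * (2 * m))
        4[2m]≢0 = ℕ.m*n≢0 4 (2 * m)

      Sols[_] : ℕ → ℕ → Pred ℤ⁴ 0ℓ
      Sols[ d ] = Sols square a a (2 * a) d

      list[_] : ℕ → ℕ → List ℤ⁴
      list[ d ] n = filter (sols? square a a (2 * a) d n) (quads (range n))

      list-Lists : ∀ d .{{_ : NonZero d}} n → list[ d ] n Lists Sols[ d ] n
      list-Lists d = N-Lists a a (2 * a) d

    last-odd-count : ℕ → ℕ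
    last-odd-count K = length (filter last-odd? (list[ 2 * m ] K))

    N[2m]≡N[8m]+last-odd-count : ∀ K → N a a (2 * a) (2 * m) K ≡ N a a (2 * a) (4 * (2 * m)) K + last-odd-count K
    N[2m]≡N[8m]+last-odd-count K = begin
      length (list[ 2 * m ] K)                                             ≡⟨ length-filter-∁ last-odd? (list[ 2 * m ] K) ⟩
      last-odd-count K + length (filter (∁? last-odd?) (list[ 2 * m ] K))  ≡⟨ cong (_+_ (last-odd-count K)) ω-count ⟨
      last-odd-count K + length (list[ 4 * (2 * m) ] K)                    ≡⟨ ℕ.+-comm (last-odd-count K) _ ⟩
      length (list[ 4 * (2 * m) ] K) + last-odd-count K                    ∎
      where
      open ≡-Reasoning
      ω-count : length (list[ 4 * (2 * m) ] K) ≡ length (filter (∁? last-odd?) (list[ 2 * m ] K))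
      ω-count = BijectionOn-length (ω-bijection a a (2 * a) (2 * m) K) (list-Lists (4 * (2 * m)) K)
                  (Lists-filter (∁? last-odd?) (list-Lists (2 * m) K))

    N[4K]≡3*N[K] : ∀ K → Odd (+ K) → N a a (2 * a) (4 * (2 * m)) (4 * K) ≡ 3 * N a a (2 * a) (2 * m) K
    N[4K]≡3*N[K] K K-odd = begin
      length L₄
        ≡⟨ length-filter-∁ first-odd? L₄ ⟩
      length Lₒ + length (filter (∁? first-odd?) L₄)
        ≡⟨ cong₂ _+_ (length-filter-∁ first≡second-mod4? Lₒ) (sym ε-count) ⟩
      length (filter first≡second-mod4? Lₒ) + length (filter (∁? first≡second-mod4?) Lₒ) + length L
        ≡⟨ cong₂ (λ u v → u + v + length L) φ₀-count φ₁-count ⟨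
      length L + length L + length L
        ≡⟨ thrice (length L) ⟩
      3 * length L ∎
      where
      open ≡-Reasoning
      L L₄ Lₒ : List ℤ⁴
      L  = list[ 2 * m ] K
      L₄ = list[ 4 * (2 * m) ] (4 * K)
      Lₒ = filter first-odd? L₄
      ε-count : length L ≡ length (filter (∁? first-odd?) L₄)
      ε-count = BijectionOn-length (ε-bijection a (2 * m) K a-odd) (list-Lists (2 * m) K)
                  (Lists-filter (∁? first-odd?) (list-Lists (4 * (2 * m)) (4 * K)))
      φ₀-count : length L ≡ length (filter first≡second-mod4? Lₒ)
      φ₀-count = BijectionOn-length (φ₀-bijection a (2 * m) K a-odd (first+second-odd a m K K-odd)) (list-Lists (2 * m) K)
                   (Lists-filter first≡second-mod4? (Lists-filter first-odd? (list-Lists (4 * (2 * m)) (4 * K))))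
      φ₁-count : length L ≡ length (filter (∁? first≡second-mod4?) Lₒ)
      φ₁-count = BijectionOn-length (φ₁-bijection a (2 * m) K a-odd (first+second-odd a m K K-odd)) (list-Lists (2 * m) K)
                   (Lists-filter (∁? first≡second-mod4?) (Lists-filter first-odd? (list-Lists (4 * (2 * m)) (4 * K))))
      thrice : ∀ k → k + k + k ≡ 3 * k
      thrice = solve-∀

    t≡2*last-odd-count : ∀ n → let K = 2 * n + 2 * m + a in
      t a a (2 * a) (4 * (2 * m)) n ≡ last-odd-count K + last-odd-count K
    t≡2*last-odd-count n = begin
      length T
        ≡⟨ length-map τ T ⟨
      length (map τ T)
        ≡⟨ length-filter-∁ first≡second-mod4? (map τ T) ⟩
      length (filter first≡second-mod4? (map τ T)) + length (filter (∁? first≡second-mod4?) (map τ T))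
        ≡⟨ cong₂ _+_ φ₀-count φ₁-count ⟨
      last-odd-count K + last-odd-count K ∎
      where
      open ≡-Reasoning
      K : ℕ
      K = 2 * n + 2 * m + a
      K-odd : Odd (+ K)
      K-odd = 2n+2m+a-odd n m a-odd
      T : List ℤ⁴
      T = filter (sols? tri a a (2 * a) (4 * (2 * m)) n) (quads (range (suc n)))
      level : 8 * n + (a + a + 2 * a + 4 * (2 * m)) ≡ 4 * K
      level = lemma n m a
        where
        lemma : ∀ n m a → 8 * n + (a + a + 2 * a + 4 * (2 * m)) ≡ 4 * (2 * n + 2 * m + a)
        lemma = solve-∀
      τ-Lists : map τ T Lists (Sols[ 4 * (2 * m) ] (4 * K) ∩ AllOdd)
      τ-Lists = subst (λ k → map τ T Lists (Sols[ 4 * (2 * m) ] k ∩ AllOdd)) level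
        (Lists-map (τ-bijection a a (2 * a) (4 * (2 * m)) n) (t-Lists a a (2 * a) (4 * (2 * m)) n))
      all-odd : ∀ {R : Pred ℤ⁴ 0ℓ} → (Sols[ 4 * (2 * m) ] (4 * K) ∩ AllOdd) ∩ R ≐
                                     ((Sols[ 4 * (2 * m) ] (4 * K) ∩ Odd ∘ first) ∩ R) ∩ Odd ∘ last
      all-odd {R} = (λ ((sol , ox , _ , _ , ow) , r) → ((sol , ox) , r) , ow) , from {R}
        where
        from : ∀ {R q} → (((Sols[ 4 * (2 * m) ] (4 * K) ∩ Odd ∘ first) ∩ R) ∩ Odd ∘ last) q →
               ((Sols[ 4 * (2 * m) ] (4 * K) ∩ AllOdd) ∩ R) q
        from {q = X , Y , Z , W} (((sol , ox) , r) , ow) with same-parity a a-odd {2 * m} {K} X Y Z W sol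
        ... | inj₁ (ex , _)       = ⊥-elim (even⇒¬odd ex ox)
        ... | inj₂ (_ , oy , oz) = (sol , ox , oy , oz , ow) , r
      φ₀-count : last-odd-count K ≡ length (filter first≡second-mod4? (map τ T))
      φ₀-count = BijectionOn-length (BijectionOn-∩ (φ₀-bijection a (2 * m) K a-odd (first+second-odd a m K K-odd)) (id , id))
                   (Lists-filter last-odd? (list-Lists (2 * m) K)) (Lists-resp all-odd (Lists-filter first≡second-mod4? τ-Lists))
      φ₁-count : last-odd-count K ≡ length (filter (∁? first≡second-mod4?) (map τ T))
      φ₁-count = BijectionOn-length (BijectionOn-∩ (φ₁-bijection a (2 * m) K a-odd (first+second-odd a m K K-odd)) (id , id))
                   (Lists-filter last-odd? (list-Lists (2 * m) K)) (Lists-resp all-odd (Lists-filter (∁? first≡second-mod4?) τ-Lists))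

open Counts

module Rationals where

  import Data.Integer as ℤ
  import Data.Integer.Properties as ℤ
  open import Data.Integer.Tactic.RingSolver using (solve-∀)
  open import Data.Nat using () renaming (_+_ to _+ℕ_; _*_ to _*ℕ_)
  open import Data.Rational using (ℚ; _/_; _+_; _*_; _-_; toℚᵘ)
  open import Data.Rational.Properties using (toℚᵘ-injective; toℚᵘ-fromℚᵘ; toℚᵘ-homo-+; toℚᵘ-homo-*)
  open import Data.Rational.Solver using (module +-*-Solver)
  open import Data.Rational.Unnormalised using (mkℚᵘ; *≡*) renaming (_+_ to _+ᵘ_; _*_ to _*ᵘ_)
  import Data.Rational.Unnormalised.Properties as ℚᵘ

  /1-+ : ∀ m n → + (m +ℕ n) / 1 ≡ + m / 1 + + n / 1
  /1-+ m n = toℚᵘ-injective (begin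
    toℚᵘ (+ (m +ℕ n) / 1)                ≈⟨ toℚᵘ-fromℚᵘ (mkℚᵘ (+ (m +ℕ n)) 0) ⟩
    mkℚᵘ (+ m ℤ.+ + n) 0                 ≈⟨ *≡* (regroup (+ m) (+ n)) ⟩
    mkℚᵘ (+ m) 0 +ᵘ mkℚᵘ (+ n) 0         ≈⟨ ℚᵘ.+-cong (toℚᵘ-fromℚᵘ (mkℚᵘ (+ m) 0)) (toℚᵘ-fromℚᵘ (mkℚᵘ (+ n) 0)) ⟨
    toℚᵘ (+ m / 1) +ᵘ toℚᵘ (+ n / 1)     ≈⟨ toℚᵘ-homo-+ (+ m / 1) (+ n / 1) ⟨
    toℚᵘ (+ m / 1 + + n / 1)             ∎)
    where
    open ℚᵘ.≃-Reasoning
    regroup : ∀ i j → (i ℤ.+ j) ℤ.* (+ 1 ℤ.* + 1) ≡ (i ℤ.* + 1 ℤ.+ j ℤ.* + 1) ℤ.* + 1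
    regroup = solve-∀

  /1-* : ∀ m n → + (m *ℕ n) / 1 ≡ (+ m / 1) * (+ n / 1)
  /1-* m n = toℚᵘ-injective (begin
    toℚᵘ (+ (m *ℕ n) / 1)                ≈⟨ toℚᵘ-fromℚᵘ (mkℚᵘ (+ (m *ℕ n)) 0) ⟩
    mkℚᵘ (+ (m *ℕ n)) 0                  ≈⟨ *≡* (cong (ℤ._* + 1) (ℤ.pos-* m n)) ⟩
    mkℚᵘ (+ m) 0 *ᵘ mkℚᵘ (+ n) 0         ≈⟨ ℚᵘ.*-cong (toℚᵘ-fromℚᵘ (mkℚᵘ (+ m) 0)) (toℚᵘ-fromℚᵘ (mkℚᵘ (+ n) 0)) ⟨
    toℚᵘ (+ m / 1) *ᵘ toℚᵘ (+ n / 1)     ≈⟨ toℚᵘ-homo-* (+ m / 1) (+ n / 1) ⟨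
    toℚᵘ ((+ m / 1) * (+ n / 1))         ∎)
    where open ℚᵘ.≃-Reasoning

  eliminate-S : ∀ T N₁ N₂ S → T ≡ S +ℕ S → N₁ ≡ 3 *ℕ (N₂ +ℕ S) →
    + T / 1 ≡ (+ 2 / 3) * (+ N₁ / 1) - (+ 2 / 1) * (+ N₂ / 1)
  eliminate-S _ _ N₂ S refl refl = begin
    + (S +ℕ S) / 1                                          ≡⟨ /1-+ S S ⟩
    s + s
      ≡⟨ solve 2 (λ s n → s :+ s := con (+ 2 / 3) :* (con (+ 3 / 1) :* (n :+ s)) :- con (+ 2 / 1) :* n) refl s n₂ ⟩
    (+ 2 / 3) * ((+ 3 / 1) * (n₂ + s)) - (+ 2 / 1) * n₂     ≡⟨ cong (λ x → (+ 2 / 3) * x - (+ 2 / 1) * n₂) N₁≡ ⟨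
    (+ 2 / 3) * (+ (3 *ℕ (N₂ +ℕ S)) / 1) - (+ 2 / 1) * n₂   ∎
    where
    open ≡-Reasoning
    open +-*-Solver
    s n₂ : ℚ
    s  = + S / 1
    n₂ = + N₂ / 1
    N₁≡ : + (3 *ℕ (N₂ +ℕ S)) / 1 ≡ (+ 3 / 1) * (n₂ + s)
    N₁≡ = trans (/1-* 3 (N₂ +ℕ S)) (cong ((+ 3 / 1) *_) (/1-+ N₂ S))

open Rationals

open import Data.Nat using (ℕ; _+_; _*_; NonZero)
open import Data.Nat using (_%_)
import Data.Nat.Properties as ℕ
open import Data.Nat.Tactic.RingSolver using (solve-∀)
open import Data.Rational using (ℚ; _-_; _/_) renaming (_*_ to _*ℚ_)
open import Data.Integer using (+_)
open import Relation.Binary.PropositionalEquality using (_≡_)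

theorem2p1 : (m n a : ℕ) → NonZero m → NonZero n → NonZero a → a % 2 ≡ 1 →
    (+ t a a (2 * a) (8 * m) n / 1)
      ≡ (+ 2 / 3) *ℚ (+ N a a (2 * a) (8 * m) (8 * n + 8 * m + 4 * a) / 1)
        - (+ 2 / 1) *ℚ (+ N a a (2 * a) (8 * m) (2 * n + 2 * m + a) / 1)
theorem2p1 m n a m≢0 _ a≢0 a%2≡1 = eliminate-S _ _ (N a a (2 * a) (8 * m) K) S t≡2S N₁≡3[N₂+S]
  where
  instance
    _ = m≢0
    _ = a≢0
  a-odd : Odd (+ a)
  a-odd = %2≡1⇒odd a a%2≡1
  K S : ℕ
  K = 2 * n + 2 * m + a
  S = last-odd-count a m a-odd K
  8m≡4[2m] : 8 * m ≡ 4 * (2 * m)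
  8m≡4[2m] = ℕ.*-assoc 4 2 m
  8n+8m+4a≡4K : 8 * n + 8 * m + 4 * a ≡ 4 * K
  8n+8m+4a≡4K = lemma n m a
    where
    lemma : ∀ n m a → 8 * n + 8 * m + 4 * a ≡ 4 * (2 * n + 2 * m + a)
    lemma = solve-∀
  t≡2S : t a a (2 * a) (8 * m) n ≡ S + S
  t≡2S = trans (cong (λ d → t a a (2 * a) d n) 8m≡4[2m]) (t≡2*last-odd-count a m a-odd n)
  N₁≡3[N₂+S] : N a a (2 * a) (8 * m) (8 * n + 8 * m + 4 * a) ≡ 3 * (N a a (2 * a) (8 * m) K + S)
  N₁≡3[N₂+S] = trans (cong₂ (N a a (2 * a)) 8m≡4[2m] 8n+8m+4a≡4K)
    (trans (N[4K]≡3*N[K] a m a-odd K (2n+2m+a-odd n m a-odd))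
      (cong (3 *_) (trans (N[2m]≡N[8m]+last-odd-count a m a-odd K) (cong (λ d → N a a (2 * a) d K + S) (sym 8m≡4[2m])))))
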